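{- Let $\mathbf{u}$ be an infinite word over a finite alphabet whose language is closed under $\Theta$. If there exists an integer $N$ such that $\mathbf{u}$ has no special factor of length $N$, then $\mathcal{P}_\Theta(n)+\mathcal{P}_\Theta(n+1)=2$ for all $n\geq N$.
   Context: $\Theta$ is an involutory antimorphism of $\mathcal{A}^*$ ($\Theta^2=\mathrm{id}$, $\Theta(vw)=\Theta(w)\Theta(v)$). A word $w$ is a $\Theta$-palindrome if $\Theta(w)=w$. The language of $\mathbf{u}$ (its set of finite factors) is closed under $\Theta$ if it contains $\Theta(w)$ for each of its elements $w$. $\mathcal{P}_\Theta(n)$ is the number of distinct factors of $\mathbf{u}$ of length $n$ that are $\Theta$-palindromes. A factor $w$ is left (right) special if there are distinct letters $a,b$ with $aw,bw$ (resp. $wa,wb$) factors of $\mathbf{u}$; it is special if it is left or right special. -}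

module Defs where

open import Data.Nat using (ℕ; _+_)
open import Data.Fin using (Fin)
open import Data.List using (List; []; _∷_; _++_; [_]; length; map; upTo)
open import Data.List.Membership.Propositional using (_∈_)
open import Data.List.Relation.Unary.Unique.Propositional using (Unique)
open import Data.Product using (Σ; ∃; _×_; _,_)
open import Data.Sum using (_⊎_)
open import Relation.Binary.PropositionalEquality using (_≡_; _≢_)
open import Function.Bundles using (_⇔_)

Word : ℕ → Set
Word k = List (Fin k)

InfWord : ℕ → Set
InfWord k = ℕ → Fin k

factorAt : ∀ {k} → InfWord k → ℕ → ℕ → Word k
factorAt u i n = map (λ j → u (i + j)) (upTo n)

Factor : ∀ {k} → InfWord k → Word k → Set
Factor u w = ∃ λ i → factorAt u i (length w) ≡ w

record IsInvolutoryAntimorphism {k : ℕ} (Θ : Word k → Word k) : Set where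
  field
    involutive : ∀ w → Θ (Θ w) ≡ w
    antimorphic : ∀ v w → Θ (v ++ w) ≡ Θ w ++ Θ v

IsΘPalindrome : ∀ {k} → (Word k → Word k) → Word k → Set
IsΘPalindrome Θ w = Θ w ≡ w

ClosedUnder : ∀ {k} → InfWord k → (Word k → Word k) → Set
ClosedUnder u Θ = ∀ w → Factor u w → Factor u (Θ w)

LeftSpecial : ∀ {k} → InfWord k → Word k → Set
LeftSpecial u w = Σ _ λ a → Σ _ λ b → a ≢ b × Factor u (a ∷ w) × Factor u (b ∷ w)

RightSpecial : ∀ {k} → InfWord k → Word k → Set
RightSpecial u w = Σ _ λ a → Σ _ λ b → a ≢ b × Factor u (w ++ [ a ]) × Factor u (w ++ [ b ])

Special : ∀ {k} → InfWord k → Word k → Set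
Special u w = Factor u w × (LeftSpecial u w ⊎ RightSpecial u w)

-- "P_Θ(n) = m": the list ws, of length m and without repetitions, enumerates
-- exactly the factors of u of length n that are Θ-palindromes.
PalCount : ∀ {k} → InfWord k → (Word k → Word k) → ℕ → ℕ → Set
PalCount {k} u Θ n m =
  Σ (List (Word k)) λ ws →
    Unique ws × length ws ≡ m ×
    (∀ w → (w ∈ ws) ⇔ (length w ≡ n × Factor u w × IsΘPalindrome Θ w))

-- Without special factors of length N, every factor of length at least N has a unique
-- extension on either side, so u is purely periodic; let p be its least period. The
-- factors of length n ≥ N are then the p pairwise distinct windows starting at 0, …, p − 1.
-- Closure under Θ makes the Θ-image of a window again a window, and extending such a pair
-- letter by letter, using uniqueness of extensions, shows that u is Θ-symmetric: there is
-- a c such that the window of length n ≥ N at position i is a Θ-palindrome iff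
-- 2i + n ≡ c (mod p). As i ranges below p, the numbers 2i + n and 2i + n + 1 together
-- range over p + p consecutive integers, exactly two of which are ≡ c (mod p).
module Submission where

open import Defs
open import Data.Bool using (Bool; true; false)
open import Data.Fin as Fin using (Fin; combine)
open import Data.Fin.Properties using (pigeonhole; combine-injective)
open import Data.List using (List; []; _∷_; _∷ʳ_; _++_; [_]; length; filter; applyUpTo)
open import Data.List.Membership.Propositional using (_∈_)
open import Data.List.Membership.Propositional.Properties using (∈-filter⁺; ∈-filter⁻; ∈-applyUpTo⁺; ∈-applyUpTo⁻)
open import Data.List.Properties using (∷-injective; ∷ʳ-injective; ≡-dec; map-upTo; ++-identityʳ-unique; length-++)
open import Data.List.Relation.Unary.Unique.Propositional using (Unique)
import Data.List.Relation.Unary.Unique.Propositional.Properties as Unique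
open import Data.Nat using (ℕ; zero; suc; _+_; _∸_; _*_; _^_; _≤_; _<_; z≤n; s≤s; _≟_; _%_; _/_; NonZero; >-nonZero⁻¹; _≥_)
open import Data.Nat.DivMod using (m<n⇒m%n≡m; [m+n]%n≡m%n; [m+kn]%n≡m%n; m≡m%n+[m/n]*n; m%n%n≡m%n; m%n<n; %-remove-+ʳ)
open import Data.Nat.Divisibility using (m%n≡0⇒n∣m)
open import Data.Nat.Induction using (<-rec)
open import Data.Nat.Properties
open import Data.Nat.Tactic.RingSolver using (solve-∀)
open import Data.Product using (Σ; ∃; ∃₂; _×_; _,_; proj₁; proj₂)
open import Data.Sum using (inj₁; inj₂)
open import Function using (_∘_; case_of_)
open import Function.Bundles using (_⇔_; mk⇔; module Equivalence)
open import Relation.Binary.PropositionalEquality hiding ([_])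
open import Relation.Nullary using (¬_; Dec; yes; no; does; contradiction)
open import Relation.Nullary.Decidable using (decidable-stable; map′; dec-true; dec-false; does-⇔)
open import Relation.Unary using (Pred; Decidable)

length≡1⇒singleton : ∀ {A : Set} (xs : List A) → length xs ≡ 1 → ∃ λ x → xs ≡ [ x ]
length≡1⇒singleton (x ∷ []) _ = x , refl

least-witness : ∀ {P : ℕ → Set} → Decidable P → ∀ {n} → P n → ∃ λ m → P m × (∀ {q} → q < m → ¬ P q)
least-witness {P} P? = <-rec _ search _
  where
  search : ∀ n → (∀ {q} → q < n → P q → ∃ λ m → P m × (∀ {q} → q < m → ¬ P q)) →
           P n → ∃ λ m → P m × (∀ {q} → q < m → ¬ P q)
  search n rec Pn with anyUpTo? P? n
  ... | yes (q , q<n , Pq) = rec q<n Pq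
  ... | no  none           = n , Pn , λ q<n Pq → none (_ , q<n , Pq)

indicator : Bool → ℕ
indicator true  = 1
indicator false = 0

count : (ℕ → Bool) → ℕ → ℕ
count g zero    = 0
count g (suc m) = indicator (g 0) + count (g ∘ suc) m

length-filter-applyUpTo : ∀ {a p} {A : Set a} {P : Pred A p} (P? : Decidable P) (f : ℕ → A) m →
  length (filter P? (applyUpTo f m)) ≡ count (λ i → does (P? (f i))) m
length-filter-applyUpTo P? f zero = refl
length-filter-applyUpTo P? f (suc m) with does (P? (f 0))
... | true  = cong suc (length-filter-applyUpTo P? (f ∘ suc) m)
... | false = length-filter-applyUpTo P? (f ∘ suc) m

count-cong : ∀ {g h} m → (∀ x → x < m → g x ≡ h x) → count g m ≡ count h m
count-cong zero    g≗h = refl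
count-cong (suc m) g≗h = cong₂ _+_ (cong indicator (g≗h 0 (s≤s z≤n)))
  (count-cong m λ x x<m → g≗h (suc x) (s≤s x<m))

count-+ : ∀ g a b → count g (a + b) ≡ count g a + count (λ x → g (a + x)) b
count-+ g zero    b = refl
count-+ g (suc a) b = trans (cong (indicator (g 0) +_) (count-+ (g ∘ suc) a b))
  (sym (+-assoc (indicator (g 0)) _ _))

count-none : ∀ {g} m → (∀ x → x < m → g x ≡ false) → count g m ≡ 0
count-none zero    _ = refl
count-none (suc m) none rewrite none 0 (s≤s z≤n) = count-none m λ x x<m → none (suc x) (s≤s x<m)

count-≟ : ∀ {r m} → r < m → count (λ x → does (x ≟ r)) m ≡ 1
count-≟ {r} (s≤s {n = m} r≤m) with m≤n⇒∃[o]m+o≡n r≤m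
... | b , refl = begin
  count (λ x → does (x ≟ r)) (suc (r + b))
    ≡⟨ cong (count _) (sym (+-suc r b)) ⟩
  count (λ x → does (x ≟ r)) (r + suc b)
    ≡⟨ count-+ _ r (suc b) ⟩
  count (λ x → does (x ≟ r)) r + (indicator (does (r + 0 ≟ r)) + count (λ x → does (r + suc x ≟ r)) b)
    ≡⟨ cong₂ _+_ (count-none r λ x x<r → dec-false (x ≟ r) (<⇒≢ x<r))
                 (cong₂ _+_ (cong indicator (dec-true (r + 0 ≟ r) (+-identityʳ r)))
                            (count-none b λ x _ → dec-false (r + suc x ≟ r) (m+1+n≢m r))) ⟩
  1 ∎
  where open ≡-Reasoning

count-rotate : ∀ g p → g p ≡ g 0 → count (g ∘ suc) p ≡ count g p
count-rotate g p gp≡g0 = +-cancelˡ-≡ (indicator (g 0)) _ _ (begin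
  count g (suc p)                         ≡⟨ cong (count g) (+-comm 1 p) ⟩
  count g (p + 1)                         ≡⟨ count-+ g p 1 ⟩
  count g p + (indicator (g (p + 0)) + 0) ≡⟨ cong (λ x → count g p + (indicator (g x) + 0)) (+-identityʳ p) ⟩
  count g p + (indicator (g p) + 0)       ≡⟨ cong (λ b → count g p + (indicator b + 0)) gp≡g0 ⟩
  count g p + (indicator (g 0) + 0)       ≡⟨ cong (count g p +_) (+-identityʳ _) ⟩
  count g p + indicator (g 0)             ≡⟨ +-comm (count g p) _ ⟩
  indicator (g 0) + count g p             ∎)
  where open ≡-Reasoning

count-shift : ∀ g p → (∀ x → g (p + x) ≡ g x) → ∀ n → count (λ x → g (n + x)) p ≡ count g p
count-shift g p periodic zero    = refl
count-shift g p periodic (suc n) = begin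
  count (λ x → g (suc n + x)) p ≡⟨ count-cong p (λ x _ → cong g (sym (+-suc n x))) ⟩
  count (λ x → g (n + suc x)) p ≡⟨ count-rotate (λ x → g (n + x)) p gₙ₊ₚ≡gₙ ⟩
  count (λ x → g (n + x)) p     ≡⟨ count-shift g p periodic n ⟩
  count g p                     ∎
  where
  open ≡-Reasoning
  gₙ₊ₚ≡gₙ : g (n + p) ≡ g (n + 0)
  gₙ₊ₚ≡gₙ = trans (cong g (+-comm n p)) (trans (periodic n) (cong g (sym (+-identityʳ n))))

count-interleave : ∀ g m → count (λ i → g (i + i)) m + count (λ i → g (suc (i + i))) m ≡ count g (m + m)
count-interleave g zero    = refl
count-interleave g (suc m) = begin
  (indicator (g 0) + count (λ i → g (suc i + suc i)) m) + (indicator (g 1) + count (λ i → g (suc (suc i + suc i))) m)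
    ≡⟨ cong₂ (λ x y → (indicator (g 0) + x) + (indicator (g 1) + y))
         (count-cong m λ i _ → cong g (+-suc (suc i) i)) (count-cong m λ i _ → cong (g ∘ suc) (+-suc (suc i) i)) ⟩
  (indicator (g 0) + count (λ i → g (2 + (i + i))) m) + (indicator (g 1) + count (λ i → g (3 + (i + i))) m)
    ≡⟨ +-assoc (indicator (g 0)) _ _ ⟩
  indicator (g 0) + (count (λ i → g (2 + (i + i))) m + (indicator (g 1) + count (λ i → g (3 + (i + i))) m))
    ≡⟨ cong (indicator (g 0) +_) (x+[y+z]≡y+[x+z] (count (λ i → g (2 + (i + i))) m) (indicator (g 1)) _) ⟩
  indicator (g 0) + (indicator (g 1) + (count (λ i → g (2 + (i + i))) m + count (λ i → g (3 + (i + i))) m))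
    ≡⟨ cong (λ x → indicator (g 0) + (indicator (g 1) + x)) (count-interleave (g ∘ suc ∘ suc) m) ⟩
  indicator (g 0) + (indicator (g 1) + count (g ∘ suc ∘ suc) (m + m))
    ≡⟨ cong (λ x → indicator (g 0) + count (g ∘ suc) x) (sym (+-suc m m)) ⟩
  count g (suc m + suc m) ∎
  where
  open ≡-Reasoning
  x+[y+z]≡y+[x+z] : ∀ x y z → x + (y + z) ≡ y + (x + z)
  x+[y+z]≡y+[x+z] x y z = trans (sym (+-assoc x y z)) (trans (cong (_+ z) (+-comm x y)) (+-assoc y x z))

count-residue : ∀ p .{{_ : NonZero p}} {r} n → r < p → count (λ x → does ((x + n) % p ≟ r)) p ≡ 1
count-residue p {r} n r<p = begin
  count (λ x → does ((x + n) % p ≟ r)) p ≡⟨ count-cong p (λ x _ → cong (λ y → does (y % p ≟ r)) (+-comm x n)) ⟩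
  count (λ x → does ((n + x) % p ≟ r)) p
    ≡⟨ count-shift (λ x → does (x % p ≟ r)) p (λ x → cong (λ y → does (y ≟ r)) (p+x%p≡x%p x)) n ⟩
  count (λ x → does (x % p ≟ r)) p
    ≡⟨ count-cong p (λ x x<p → cong (λ y → does (y ≟ r)) (m<n⇒m%n≡m x<p)) ⟩
  count (λ x → does (x ≟ r)) p           ≡⟨ count-≟ r<p ⟩
  1                                      ∎
  where
  open ≡-Reasoning
  p+x%p≡x%p : ∀ x → (p + x) % p ≡ x % p
  p+x%p≡x%p x = trans (cong (_% p) (+-comm p x)) ([m+n]%n≡m%n x p)

count-residue-pairs : ∀ p .{{_ : NonZero p}} {r} n → r < p →
  count (λ i → does ((i + i + n) % p ≟ r)) p + count (λ i → does ((i + i + (n + 1)) % p ≟ r)) p ≡ 2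
count-residue-pairs p {r} n r<p = begin
  count (λ i → g (i + i)) p + count (λ i → does ((i + i + (n + 1)) % p ≟ r)) p
    ≡⟨ cong (count (λ i → g (i + i)) p +_) (count-cong p λ i _ → cong (λ x → does (x % p ≟ r)) (rearrange i n)) ⟩
  count (λ i → g (i + i)) p + count (λ i → g (suc (i + i))) p
    ≡⟨ count-interleave g p ⟩
  count g (p + p)
    ≡⟨ count-+ g p p ⟩
  count g p + count (λ x → g (p + x)) p
    ≡⟨ cong (count g p +_) (count-cong p λ x _ → cong (λ y → does (y ≟ r)) (p+x+n%p≡x+n%p x)) ⟩
  count g p + count g p
    ≡⟨ cong₂ _+_ (count-residue p n r<p) (count-residue p n r<p) ⟩
  2 ∎
  where
  open ≡-Reasoning
  g : ℕ → Bool
  g x = does ((x + n) % p ≟ r)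
  rearrange : ∀ i n → i + i + (n + 1) ≡ suc (i + i) + n
  rearrange = solve-∀
  p+x+n%p≡x+n%p : ∀ x → (p + x + n) % p ≡ (x + n) % p
  p+x+n%p≡x+n%p x = trans (cong (_% p) (trans (+-assoc p x n) (+-comm p (x + n)))) ([m+n]%n≡m%n (x + n) p)

module Windows {k : ℕ} (u : InfWord k) where

  window : ℕ → ℕ → Word k
  window i zero    = []
  window i (suc n) = u i ∷ window (suc i) n

  length-window : ∀ i n → length (window i n) ≡ n
  length-window i zero    = refl
  length-window i (suc n) = cong suc (length-window (suc i) n)

  window-∷ʳ : ∀ i n → window i (suc n) ≡ window i n ∷ʳ u (i + n)
  window-∷ʳ i zero    = cong (λ x → u x ∷ []) (sym (+-identityʳ i))
  window-∷ʳ i (suc n) = cong (u i ∷_) (begin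
    window (suc i) (suc n)        ≡⟨ window-∷ʳ (suc i) n ⟩
    window (suc i) n ∷ʳ u (suc i + n) ≡⟨ cong (λ x → window (suc i) n ∷ʳ u x) (sym (+-suc i n)) ⟩
    window (suc i) n ∷ʳ u (i + suc n) ∎)
    where open ≡-Reasoning

  applyUpTo≡window : ∀ {f : ℕ → Fin k} i n → (∀ j → f j ≡ u (i + j)) → applyUpTo f n ≡ window i n
  applyUpTo≡window i zero    f≗ = refl
  applyUpTo≡window i (suc n) f≗ = cong₂ _∷_
    (trans (f≗ 0) (cong u (+-identityʳ i)))
    (applyUpTo≡window (suc i) n λ j → trans (f≗ (suc j)) (cong u (+-suc i j)))

  factorAt≡window : ∀ i n → factorAt u i n ≡ window i n
  factorAt≡window i n = trans (map-upTo _ n) (applyUpTo≡window i n λ _ → refl)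

  window-Factor : ∀ i n → Factor u (window i n)
  window-Factor i n = i , trans (factorAt≡window i _) (cong (window i) (length-window i n))

  Factor⇒window : ∀ {w} → Factor u w → ∃ λ i → window i (length w) ≡ w
  Factor⇒window (i , e) = i , trans (sym (factorAt≡window i _)) e

  window≡-prefix : ∀ {i j m n} → m ≤ n → window i n ≡ window j n → window i m ≡ window j m
  window≡-prefix z≤n       _ = refl
  window≡-prefix (s≤s m≤n) e = cong₂ _∷_ (proj₁ (∷-injective e)) (window≡-prefix m≤n (proj₂ (∷-injective e)))

  SameTail : ℕ → ℕ → Set
  SameTail i j = ∀ m → u (i + m) ≡ u (j + m)

  SameTail-suc : ∀ {i j} → SameTail i j → SameTail (suc i) (suc j)
  SameTail-suc {i} {j} eq m = trans (cong u (sym (+-suc i m))) (trans (eq (suc m)) (cong u (+-suc j m)))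

  SameTail-head : ∀ {i j} → SameTail i j → u i ≡ u j
  SameTail-head {i} {j} eq = trans (cong u (sym (+-identityʳ i))) (trans (eq 0) (cong u (+-identityʳ j)))

  SameTail⇒window≡ : ∀ {i j} → SameTail i j → ∀ n → window i n ≡ window j n
  SameTail⇒window≡ eq zero    = refl
  SameTail⇒window≡ eq (suc n) = cong₂ _∷_ (SameTail-head eq) (SameTail⇒window≡ (SameTail-suc eq) n)

  SameTail-sym : ∀ {i j} → SameTail i j → SameTail j i
  SameTail-sym eq m = sym (eq m)

  SameTail-trans : ∀ {i j l} → SameTail i j → SameTail j l → SameTail i l
  SameTail-trans eq eq′ m = trans (eq m) (eq′ m)

  SameTail-+ʳ : ∀ {i j} a → SameTail i j → SameTail (i + a) (j + a)
  SameTail-+ʳ {i} {j} a eq m =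
    trans (cong u (+-assoc i a m)) (trans (eq (a + m)) (cong u (sym (+-assoc j a m))))

  module _ {p : ℕ} (period : SameTail 0 p) where

    SameTail-multiple-+ : ∀ K a → SameTail (K * p + a) a
    SameTail-multiple-+ zero    a m = refl
    SameTail-multiple-+ (suc K) a = SameTail-trans
      (λ m → cong u (cong (_+ m) (+-assoc p (K * p) a)))
      (SameTail-trans (SameTail-sym (SameTail-+ʳ (K * p + a) period)) (SameTail-multiple-+ K a))

    SameTail-% : .{{_ : NonZero p}} → ∀ i → SameTail i (i % p)
    SameTail-% i = subst (λ x → SameTail x (i % p)) i≡ (SameTail-multiple-+ (i / p) (i % p))
      where
      i≡ : i / p * p + i % p ≡ i
      i≡ = trans (+-comm (i / p * p) (i % p)) (sym (m≡m%n+[m/n]*n i p))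

    ≡-mod⇒SameTail : .{{_ : NonZero p}} → ∀ {i j} → i % p ≡ j % p → SameTail i j
    ≡-mod⇒SameTail {i} {j} eq = SameTail-trans (SameTail-% i)
      (subst (λ x → SameTail x j) (sym eq) (SameTail-sym (SameTail-% j)))

  window-code : ℕ → (n : ℕ) → Fin (k ^ n)
  window-code i zero    = Fin.zero
  window-code i (suc n) = combine (u i) (window-code (suc i) n)

  window-code-injective : ∀ i j n → window-code i n ≡ window-code j n → window i n ≡ window j n
  window-code-injective i j zero    _  = refl
  window-code-injective i j (suc n) eq with combine-injective (u i) _ (u j) _ eq
  ... | head≡ , tail≡ = cong₂ _∷_ head≡ (window-code-injective (suc i) (suc j) n tail≡)

  repeated-window : ∀ n → ∃₂ λ i d → window i n ≡ window (i + suc d) n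
  repeated-window n with pigeonhole (n<1+n (k ^ n)) (λ x → window-code (Fin.toℕ x) n)
  ... | x , y , x<y , code≡ with m≤n⇒∃[o]m+o≡n x<y
  ... | d , y≡ = Fin.toℕ x , d ,
        trans (window-code-injective _ _ n code≡) (cong (λ z → window z n) (trans (sym y≡) (sym (+-suc (Fin.toℕ x) d))))

module Antimorphism {k : ℕ} {Θ : Word k → Word k} (isInv : IsInvolutoryAntimorphism Θ) where
  open IsInvolutoryAntimorphism isInv

  Θ-[] : Θ [] ≡ []
  Θ-[] = ++-identityʳ-unique (Θ []) (antimorphic [] [])

  1≤length-Θ-singleton : ∀ a → 1 ≤ length (Θ [ a ])
  1≤length-Θ-singleton a with Θ [ a ] in eq
  ... | _ ∷ _ = s≤s z≤n
  ... | []    = case trans (sym (involutive [ a ])) (trans (cong Θ eq) Θ-[]) of λ ()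

  length≤length-Θ : ∀ w → length w ≤ length (Θ w)
  length≤length-Θ []      = z≤n
  length≤length-Θ (a ∷ w) = begin
    suc (length w)                   ≡⟨ +-comm 1 (length w) ⟩
    length w + 1                     ≤⟨ +-mono-≤ (length≤length-Θ w) (1≤length-Θ-singleton a) ⟩
    length (Θ w) + length (Θ [ a ])  ≡⟨ sym (length-++ (Θ w)) ⟩
    length (Θ w ++ Θ [ a ])          ≡⟨ cong length (sym (antimorphic [ a ] w)) ⟩
    length (Θ (a ∷ w))               ∎
    where open ≤-Reasoning

  length-Θ : ∀ w → length (Θ w) ≡ length w
  length-Θ w = ≤-antisym
    (≤-trans (length≤length-Θ (Θ w)) (≤-reflexive (cong length (involutive w))))
    (length≤length-Θ w)

  θ : Fin k → Fin k
  θ a = proj₁ (length≡1⇒singleton (Θ [ a ]) (length-Θ [ a ]))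

  Θ-singleton : ∀ a → Θ [ a ] ≡ [ θ a ]
  Θ-singleton a = proj₂ (length≡1⇒singleton (Θ [ a ]) (length-Θ [ a ]))

module NoSpecialFactor {k : ℕ} (u : InfWord k) (N : ℕ) (noSpecial : ∀ w → length w ≡ N → ¬ Special u w) where
  open Windows u

  right-extension-unique : ∀ {i j} → window i N ≡ window j N → u (i + N) ≡ u (j + N)
  right-extension-unique {i} {j} eq = decidable-stable (u (i + N) Fin.≟ u (j + N)) λ ≢ →
    noSpecial (window i N) (length-window i N) (window-Factor i N , inj₂ (u (i + N) , u (j + N) , ≢ ,
      subst (Factor u) (window-∷ʳ i N) (window-Factor i (suc N)) ,
      subst (Factor u) (trans (window-∷ʳ j N) (cong (_∷ʳ u (j + N)) (sym eq))) (window-Factor j (suc N))))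

  left-extension-unique : ∀ {i j} → window (suc i) N ≡ window (suc j) N → u i ≡ u j
  left-extension-unique {i} {j} eq = decidable-stable (u i Fin.≟ u j) λ ≢ →
    noSpecial (window (suc i) N) (length-window (suc i) N) (window-Factor (suc i) N , inj₁ (u i , u j , ≢ ,
      window-Factor i (suc N) ,
      subst (λ w → Factor u (u j ∷ w)) (sym eq) (window-Factor j (suc N))))

  window≡⇒SameTail : ∀ {i j n} → N ≤ n → window i n ≡ window j n → SameTail i j
  window≡⇒SameTail N≤n eq = propagate (window≡-prefix N≤n eq)
    where
    propagate : ∀ {i j} → window i N ≡ window j N → SameTail i j
    propagate {i} {j} eq m with ∷-injective (begin
      window i (suc N)          ≡⟨ window-∷ʳ i N ⟩
      window i N ∷ʳ u (i + N)   ≡⟨ cong₂ _∷ʳ_ eq (right-extension-unique eq) ⟩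
      window j N ∷ʳ u (j + N)   ≡⟨ sym (window-∷ʳ j N) ⟩
      window j (suc N)          ∎)
      where open ≡-Reasoning
    propagate {i} {j} eq zero    | head≡ , _ =
      trans (cong u (+-identityʳ i)) (trans head≡ (cong u (sym (+-identityʳ j))))
    propagate {i} {j} eq (suc m) | _ , tail≡ =
      trans (cong u (+-suc i m)) (trans (propagate tail≡ m) (cong u (sym (+-suc j m))))

  SameTail-cancelˡ : ∀ a {i j} → SameTail (a + i) (a + j) → SameTail i j
  SameTail-cancelˡ zero    eq = eq
  SameTail-cancelˡ (suc a) eq = SameTail-cancelˡ a (cancel eq)
    where
    cancel : ∀ {i j} → SameTail (suc i) (suc j) → SameTail i j
    cancel {i} {j} eq zero    = trans (cong u (+-identityʳ i))
      (trans (left-extension-unique (SameTail⇒window≡ eq N)) (cong u (sym (+-identityʳ j))))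
    cancel {i} {j} eq (suc m) = trans (cong u (+-suc i m)) (trans (eq m) (cong u (sym (+-suc j m))))

  SameTail-0 : ∀ i {d} → SameTail i (i + d) → SameTail 0 d
  SameTail-0 i eq = SameTail-cancelˡ i (subst (λ x → SameTail x (i + _)) (sym (+-identityʳ i)) eq)

  SameTail? : ∀ i j → Dec (SameTail i j)
  SameTail? i j = map′ (window≡⇒SameTail ≤-refl) (λ eq → SameTail⇒window≡ eq N)
    (≡-dec Fin._≟_ (window i N) (window j N))

  minimal-period : ∃ λ d → SameTail 0 (suc d) × (∀ {q} → q < d → ¬ SameTail 0 (suc q))
  minimal-period with repeated-window N
  ... | i , d , eq = least-witness (λ d → SameTail? 0 (suc d))
        (SameTail-0 i (window≡⇒SameTail ≤-refl eq))

  module _ (p : ℕ) .{{_ : NonZero p}} (period : SameTail 0 p)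
           (minimal : ∀ {q} → suc q < p → ¬ SameTail 0 (suc q)) where

    SameTail-0⇒%≡0 : ∀ {d} → SameTail 0 d → d % p ≡ 0
    SameTail-0⇒%≡0 {d} eq with d % p in d%p≡ | m%n<n d p
    ... | zero  | _      = refl
    ... | suc q | q<p = contradiction
      (subst (SameTail 0) d%p≡ (SameTail-trans eq (SameTail-% period d))) (minimal q<p)

    SameTail⇒≡-mod-≤ : ∀ {i j} → i ≤ j → SameTail i j → i % p ≡ j % p
    SameTail⇒≡-mod-≤ {i} i≤j eq with m≤n⇒∃[o]m+o≡n i≤j
    ... | d , refl = sym (%-remove-+ʳ i (m%n≡0⇒n∣m d p
          (SameTail-0⇒%≡0 (SameTail-0 i eq))))

    SameTail⇒≡-mod : ∀ {i j} → SameTail i j → i % p ≡ j % p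
    SameTail⇒≡-mod {i} {j} eq with ≤-total i j
    ... | inj₁ i≤j = SameTail⇒≡-mod-≤ i≤j eq
    ... | inj₂ j≤i = sym (SameTail⇒≡-mod-≤ j≤i (SameTail-sym eq))

  purely-periodic : ∃ λ p → ∀ i j → SameTail i j ⇔ i % suc p ≡ j % suc p
  purely-periodic with minimal-period
  ... | d , period , minimal = d , λ i j → mk⇔
        (SameTail⇒≡-mod (suc d) period (λ { (s≤s q<d) → minimal q<d }))
        (≡-mod⇒SameTail period)

module Palindromes {k : ℕ} (u : InfWord k) {Θ : Word k → Word k} (isInv : IsInvolutoryAntimorphism Θ)
  (closed : ClosedUnder u Θ) (N : ℕ) (noSpecial : ∀ w → length w ≡ N → ¬ Special u w)
  (p : ℕ) .{{_ : NonZero p}} (periodic : ∀ i j → Windows.SameTail u i j ⇔ i % p ≡ j % p) where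

  open Windows u
  open IsInvolutoryAntimorphism isInv
  open Antimorphism isInv
  open NoSpecialFactor u N noSpecial using (window≡⇒SameTail; left-extension-unique)

  Θ-window-sucˡ : ∀ i n → Θ (window i (suc n)) ≡ Θ (window (suc i) n) ∷ʳ θ (u i)
  Θ-window-sucˡ i n = trans (antimorphic [ u i ] (window (suc i) n)) (cong (Θ (window (suc i) n) ++_) (Θ-singleton (u i)))

  Θ-window-sucʳ : ∀ i n → Θ (window i (suc n)) ≡ θ (u (i + n)) ∷ Θ (window i n)
  Θ-window-sucʳ i n = trans (cong Θ (window-∷ʳ i n))
    (trans (antimorphic (window i n) [ u (i + n) ]) (cong (_++ Θ (window i n)) (Θ-singleton (u (i + n)))))

  Θ-window-Factor : ∀ i n → ∃ λ q → window q n ≡ Θ (window i n)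
  Θ-window-Factor i n with Factor⇒window (closed (window i n) (window-Factor i n))
  ... | q , eq = q , subst (λ m → window q m ≡ Θ (window i n)) (trans (length-Θ (window i n)) (length-window i n)) eq

  Θ-window-extendˡ : ∀ {i j n} → N ≤ n → Θ (window (suc i) n) ≡ window j n → Θ (window i (suc n)) ≡ window j (suc n)
  Θ-window-extendˡ {i} {j} {n} N≤n eq with Θ-window-Factor i (suc n)
  ... | q , q≡ with ∷ʳ-injective (window q n) (window j n) (begin
        window q n ∷ʳ u (q + n)            ≡⟨ sym (window-∷ʳ q n) ⟩
        window q (suc n)                   ≡⟨ q≡ ⟩
        Θ (window i (suc n))               ≡⟨ Θ-window-sucˡ i n ⟩
        Θ (window (suc i) n) ∷ʳ θ (u i)    ≡⟨ cong (_∷ʳ θ (u i)) eq ⟩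
        window j n ∷ʳ θ (u i)              ∎)
    where open ≡-Reasoning
  ... | window≡ , last≡ = begin
        Θ (window i (suc n))               ≡⟨ Θ-window-sucˡ i n ⟩
        Θ (window (suc i) n) ∷ʳ θ (u i)    ≡⟨ cong₂ _∷ʳ_ eq (sym last≡) ⟩
        window j n ∷ʳ u (q + n)            ≡⟨ cong (window j n ∷ʳ_) (window≡⇒SameTail N≤n window≡ n) ⟩
        window j n ∷ʳ u (j + n)            ≡⟨ sym (window-∷ʳ j n) ⟩
        window j (suc n)                   ∎
    where open ≡-Reasoning

  Θ-window-extendʳ : ∀ {i j n} → N ≤ n → Θ (window i n) ≡ window (suc j) n → Θ (window i (suc n)) ≡ window j (suc n)
  Θ-window-extendʳ {i} {j} {n} N≤n eq with Θ-window-Factor i (suc n)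
  ... | q , q≡ with ∷-injective (begin
        u q ∷ window (suc q) n             ≡⟨ q≡ ⟩
        Θ (window i (suc n))               ≡⟨ Θ-window-sucʳ i n ⟩
        θ (u (i + n)) ∷ Θ (window i n)     ≡⟨ cong (θ (u (i + n)) ∷_) eq ⟩
        θ (u (i + n)) ∷ window (suc j) n   ∎)
    where open ≡-Reasoning
  ... | first≡ , window≡ = begin
        Θ (window i (suc n))               ≡⟨ Θ-window-sucʳ i n ⟩
        θ (u (i + n)) ∷ Θ (window i n)     ≡⟨ cong₂ _∷_ (sym first≡) eq ⟩
        u q ∷ window (suc j) n             ≡⟨ cong (_∷ window (suc j) n) (left-extension-unique
                                                (window≡-prefix N≤n window≡)) ⟩
        window j (suc n)                   ∎
    where open ≡-Reasoning

  Θ-window-extendˡ⋆ : ∀ i {j n} → N ≤ n → Θ (window i n) ≡ window j n → Θ (window 0 (i + n)) ≡ window j (i + n)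
  Θ-window-extendˡ⋆ zero    N≤n eq = eq
  Θ-window-extendˡ⋆ (suc i) {j} {n} N≤n eq = subst (λ m → Θ (window 0 m) ≡ window j m) (+-suc i n)
    (Θ-window-extendˡ⋆ i (m≤n⇒m≤1+n N≤n) (Θ-window-extendˡ N≤n eq))

  Θ-window-extendʳ⋆ : ∀ j {n} → N ≤ n → Θ (window 0 n) ≡ window j n → Θ (window 0 (j + n)) ≡ window 0 (j + n)
  Θ-window-extendʳ⋆ zero    N≤n eq = eq
  Θ-window-extendʳ⋆ (suc j) {n} N≤n eq = subst (λ m → Θ (window 0 m) ≡ window 0 m) (+-suc j n)
    (Θ-window-extendʳ⋆ j (m≤n⇒m≤1+n N≤n) (Θ-window-extendʳ N≤n eq))

  Mirror : ℕ → ℕ → ℕ → Set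
  Mirror i j n = ∀ t s → suc (t + s) ≡ n → θ (u (i + t)) ≡ u (j + s)

  Θ-window≡⇒Mirror : ∀ i j n → Θ (window i n) ≡ window j n → Mirror i j n
  Θ-window≡⇒Mirror i j (suc n) eq t s t+s<n
    with ∷ʳ-injective _ _ (trans (sym (Θ-window-sucˡ i n)) (trans eq (window-∷ʳ j n)))
  Θ-window≡⇒Mirror i j (suc n) eq zero    s refl | _ , last≡ = trans (cong (θ ∘ u) (+-identityʳ i)) last≡
  Θ-window≡⇒Mirror i j (suc n) eq (suc t) s t+s<n | window≡ , _ =
    trans (cong (θ ∘ u) (+-suc i t)) (Θ-window≡⇒Mirror (suc i) j n window≡ t s (suc-injective t+s<n))

  Mirror⇒Θ-window≡ : ∀ i j n → Mirror i j n → Θ (window i n) ≡ window j n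
  Mirror⇒Θ-window≡ i j zero    mirror = Θ-[]
  Mirror⇒Θ-window≡ i j (suc n) mirror = begin
    Θ (window i (suc n))               ≡⟨ Θ-window-sucˡ i n ⟩
    Θ (window (suc i) n) ∷ʳ θ (u i)    ≡⟨ cong₂ _∷ʳ_ (Mirror⇒Θ-window≡ (suc i) j n mirror′) last≡ ⟩
    window j n ∷ʳ u (j + n)            ≡⟨ sym (window-∷ʳ j n) ⟩
    window j (suc n)                   ∎
    where
    open ≡-Reasoning
    mirror′ : Mirror (suc i) j n
    mirror′ t s t+s<n = trans (cong (θ ∘ u) (sym (+-suc i t))) (mirror (suc t) s (cong suc t+s<n))
    last≡ : θ (u i) ≡ u (j + n)
    last≡ = trans (cong (θ ∘ u) (sym (+-identityʳ i))) (mirror 0 n refl)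

  PalindromicPrefix : ℕ → Set
  PalindromicPrefix = Mirror 0 0

  -- c is twice a centre of Θ-symmetry of u: θ (u t) ≡ u s whenever t + s + 1 = c + K * p.
  Centre : ℕ → Set
  Centre c = ∀ K → PalindromicPrefix (c + K * p)

  SameTail-+-multiple : ∀ i K → SameTail (i + K * p) i
  SameTail-+-multiple i K = Equivalence.from (periodic (i + K * p) i) ([m+kn]%n≡m%n i K p)

  Θ-window≡⇒Centre : ∀ {i j n} → N ≤ n → Θ (window i n) ≡ window j n → Centre (i + j + n)
  Θ-window≡⇒Centre {i} {j} {n} N≤n eq K = Θ-window≡⇒Mirror 0 0 _
    (subst (λ m → Θ (window 0 m) ≡ window 0 m) (rearrange i j n K p)
      (Θ-window-extendʳ⋆ (j + K * p) (≤-trans N≤n (m≤n+m n i))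
        (Θ-window-extendˡ⋆ i N≤n (trans eq (SameTail⇒window≡ (SameTail-sym (SameTail-+-multiple j K)) n)))))
    where
    rearrange : ∀ i j n K p → j + K * p + (i + n) ≡ i + j + n + K * p
    rearrange = solve-∀

  PalindromicPrefix-down : ∀ K m → PalindromicPrefix (m + K * p) → PalindromicPrefix m
  PalindromicPrefix-down K m pal t s t+s<m = begin
    θ (u t)           ≡⟨ cong θ (SameTail-head (SameTail-sym (SameTail-+-multiple t K))) ⟩
    θ (u (t + K * p)) ≡⟨ pal (t + K * p) s (trans (rearrange t s K p) (cong (_+ K * p) t+s<m)) ⟩
    u s               ∎
    where
    open ≡-Reasoning
    rearrange : ∀ t s K p → suc (t + K * p + s) ≡ suc (t + s) + K * p
    rearrange = solve-∀

  Centre⇒Θ-palindrome : ∀ i n → Centre (i + i + n) → Θ (window i n) ≡ window i n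
  Centre⇒Θ-palindrome i n centre = Mirror⇒Θ-window≡ i i n λ t s t+s<n →
    PalindromicPrefix-down 0 _ (centre 0) (i + t) (i + s) (trans (rearrange i t s) (cong (i + i +_) t+s<n))
    where
    rearrange : ∀ i t s → suc (i + t + (i + s)) ≡ i + i + suc (t + s)
    rearrange = solve-∀

  Centre-≡-mod : ∀ {x y} → Centre x → x % p ≡ y % p → Centre y
  Centre-≡-mod {x} {y} centre x≡y K =
    PalindromicPrefix-down (x / p) (y + K * p) (subst PalindromicPrefix x+[y/p+K]p≡ (centre (y / p + K)))
    where
    open ≡-Reasoning
    rearrange : ∀ r a b K p → r + a * p + (b + K) * p ≡ r + b * p + K * p + a * p
    rearrange = solve-∀
    x+[y/p+K]p≡ : x + (y / p + K) * p ≡ y + K * p + x / p * p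
    x+[y/p+K]p≡ = begin
      x + (y / p + K) * p                     ≡⟨ cong (_+ (y / p + K) * p) (m≡m%n+[m/n]*n x p) ⟩
      x % p + x / p * p + (y / p + K) * p     ≡⟨ cong (λ r → r + x / p * p + (y / p + K) * p) x≡y ⟩
      y % p + x / p * p + (y / p + K) * p     ≡⟨ rearrange (y % p) (x / p) (y / p) K p ⟩
      y % p + y / p * p + K * p + x / p * p   ≡⟨ cong (λ z → z + K * p + x / p * p) (sym (m≡m%n+[m/n]*n y p)) ⟩
      y + K * p + x / p * p                   ∎

  Centre-unique-≤ : ∀ {x y} → x ≤ y → Centre x → Centre y → x % p ≡ y % p
  Centre-unique-≤ {x} x≤y centreˣ centreʸ with m≤n⇒∃[o]m+o≡n x≤y
  ... | d , refl = sym (%-remove-+ʳ x (m%n≡0⇒n∣m d p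
        (sym (trans (sym (m<n⇒m%n≡m (>-nonZero⁻¹ p))) (Equivalence.to (periodic 0 d) tail≡)))))
    where
    -- Read u s through both symmetries, reflecting at a point t far enough to the right.
    tail≡ : SameTail 0 d
    tail≡ s = begin
      u s         ≡⟨ sym (centreˣ (suc s) t s t+s<M) ⟩
      θ (u t)     ≡⟨ centreʸ (suc s) t (s + d) (shift t s d x (suc s * p) t+s<M) ⟩
      u (s + d)   ≡⟨ cong u (+-comm s d) ⟩
      u (d + s)   ∎
      where
      open ≡-Reasoning
      M t : ℕ
      M = x + suc s * p
      t = M ∸ suc s
      t+s<M : suc (t + s) ≡ M
      t+s<M = trans (sym (+-suc t s)) (m∸n+n≡m (≤-trans (m≤m*n (suc s) p) (m≤n+m _ x)))
      shift : ∀ t s d x q → suc (t + s) ≡ x + q → suc (t + (s + d)) ≡ x + d + q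
      shift t s d x q eq = trans (lhs t s d) (trans (cong (_+ d) eq) (rhs x q d))
        where
        lhs : ∀ t s d → suc (t + (s + d)) ≡ suc (t + s) + d
        lhs = solve-∀
        rhs : ∀ x q d → x + q + d ≡ x + d + q
        rhs = solve-∀

  Centre-unique : ∀ {x y} → Centre x → Centre y → x % p ≡ y % p
  Centre-unique {x} {y} centreˣ centreʸ with ≤-total x y
  ... | inj₁ x≤y = Centre-unique-≤ x≤y centreˣ centreʸ
  ... | inj₂ y≤x = sym (Centre-unique-≤ y≤x centreʸ centreˣ)

  centre : ∃ Centre
  centre with Θ-window-Factor 0 N
  ... | q , window≡ = _ , Θ-window≡⇒Centre ≤-refl (sym window≡)

  Θ-palindrome-window⇔ : ∀ {n} i → N ≤ n →
    IsΘPalindrome Θ (window i n) ⇔ (i + i + n) % p ≡ proj₁ centre % p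
  Θ-palindrome-window⇔ {n} i N≤n = mk⇔
    (λ pal → Centre-unique (Θ-window≡⇒Centre N≤n pal) (proj₂ centre))
    (λ ≡c → Centre⇒Θ-palindrome i n (Centre-≡-mod (proj₂ centre) (sym ≡c)))

  window-injective : ∀ {i j n} → N ≤ n → i < p → j < p → window i n ≡ window j n → i ≡ j
  window-injective N≤n i<p j<p window≡ = trans (sym (m<n⇒m%n≡m i<p))
    (trans (Equivalence.to (periodic _ _) (window≡⇒SameTail N≤n window≡)) (m<n⇒m%n≡m j<p))

  window-% : ∀ i n → window i n ≡ window (i % p) n
  window-% i n = SameTail⇒window≡ (Equivalence.from (periodic i (i % p)) (sym (m%n%n≡m%n i p))) n

  Θ-palindrome? : ∀ w → Dec (IsΘPalindrome Θ w)
  Θ-palindrome? w = ≡-dec Fin._≟_ (Θ w) w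

  palindromes : ℕ → List (Word k)
  palindromes n = filter Θ-palindrome? (applyUpTo (λ i → window i n) p)

  palindromes-PalCount : ∀ {n} → N ≤ n → PalCount u Θ n (length (palindromes n))
  palindromes-PalCount {n} N≤n = palindromes n , unique , refl , λ w → mk⇔ sound complete
    where
    unique : Unique (palindromes n)
    unique = Unique.filter⁺ Θ-palindrome? (Unique.applyUpTo⁺₁ (λ i → window i n) p λ i<j j<p window≡ →
      <⇒≢ i<j (window-injective N≤n (<-trans i<j j<p) j<p window≡))
    sound : ∀ {w} → w ∈ palindromes n → length w ≡ n × Factor u w × IsΘPalindrome Θ w
    sound w∈ with ∈-filter⁻ Θ-palindrome? {xs = applyUpTo (λ i → window i n) p} w∈
    ... | w∈windows , pal with ∈-applyUpTo⁻ (λ i → window i n) w∈windows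
    ... | i , _ , refl = length-window i n , window-Factor i n , pal
    complete : ∀ {w} → length w ≡ n × Factor u w × IsΘPalindrome Θ w → w ∈ palindromes n
    complete {w} (refl , factor , pal) with Factor⇒window factor
    ... | i , window≡ = ∈-filter⁺ Θ-palindrome?
          (subst (_∈ applyUpTo (λ i → window i n) p) (trans (sym (window-% i n)) window≡)
            (∈-applyUpTo⁺ (λ i → window i n) (m%n<n i p)))
          pal

  length-palindromes : ∀ {n} → N ≤ n →
    length (palindromes n) ≡ count (λ i → does ((i + i + n) % p ≟ proj₁ centre % p)) p
  length-palindromes {n} N≤n = trans (length-filter-applyUpTo Θ-palindrome? _ p)
    (count-cong p λ i _ → does-⇔ (Θ-palindrome-window⇔ i N≤n) (Θ-palindrome? _) (_ ≟ _))

lemma3p1 : (k : ℕ) (u : InfWord k) (Θ : Word k → Word k) →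
    IsInvolutoryAntimorphism Θ → ClosedUnder u Θ →
    (N : ℕ) → (∀ w → length w ≡ N → ¬ Special u w) →
    ∀ n → n ≥ N →
    Σ ℕ λ p → Σ ℕ λ q → PalCount u Θ n p × PalCount u Θ (n + 1) q × p + q ≡ 2
lemma3p1 k u Θ isInv closed N noSpecial n N≤n =
  length (palindromes n) , length (palindromes (n + 1)) ,
  palindromes-PalCount N≤n , palindromes-PalCount N≤n+1 ,
  (begin
    length (palindromes n) + length (palindromes (n + 1))
      ≡⟨ cong₂ _+_ (length-palindromes N≤n) (length-palindromes N≤n+1) ⟩
    count (λ i → does ((i + i + n) % p ≟ c % p)) p + count (λ i → does ((i + i + (n + 1)) % p ≟ c % p)) p
      ≡⟨ count-residue-pairs p n (m%n<n c p) ⟩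
    2 ∎)
  where
  open ≡-Reasoning
  periodicity : ∃ λ p → ∀ i j → Windows.SameTail u i j ⇔ i % suc p ≡ j % suc p
  periodicity = NoSpecialFactor.purely-periodic u N noSpecial
  p : ℕ
  p = suc (proj₁ periodicity)
  open Palindromes u isInv closed N noSpecial p (proj₂ periodicity)
  c : ℕ
  c = proj₁ centre
  N≤n+1 : N ≤ n + 1
  N≤n+1 = ≤-trans N≤n (m≤m+n n 1)
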